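{- Let $S$ be a regular diagram and $k\ge 1$. Then $S$ is $k$-noncrossing if and only if its block matrix $\mathbf B(S)$ is a $k$-noncrossing matrix.
   Context: A diagram of length $n$ is a simple graph on sites $\{1,\dots,n\}$ whose edges (arcs) are pairs $(s_1,s_2)$ with $s_1<s_2$ and $1<s_2-s_1<n-1$, supported by $s_1,s_2$. A diagram is binary if it has at least one arc and each site supports at most one arc. A site is free if it supports no arc. Arcs $(s_1,s_2),(s_1',s_2')$ cross if $s_1<s_1'<s_2<s_2'$ or $s_1'<s_1<s_2'<s_2$; a diagram is $k$-noncrossing if it has no $k+1$ pairwise crossing arcs. If $u_1<\dots<u_f$ are the free sites, $u_0=0$, $u_{f+1}=n+1$, the $i$-th block $B_i$ is the set of sites $s$ with $u_{i-1}<s<u_i$. The block matrix $\mathbf B(S)=(b_{i,j})$ is the symmetric $(f+1)\times(f+1)$ matrix where, for $i\ne j$, $b_{i,j}$ is the number of arcs with one supporting site in $B_i$ and the other in $B_j$, and $b_{i,i}$ is the number of arcs with both supporting sites in $B_i$. A diagram is regular if it is binary and no two crossing arcs have supporting sites lying in a common block. In a matrix, entries $x_{i,j}$ and $x_{p,q}$ cross if $i,j,p,q$ are distinct and $\min\{i,j\}<\min\{p,q\}<\max\{i,j\}<\max\{p,q\}$ or $\min\{p,q\}<\min\{i,j\}<\max\{p,q\}<\max\{i,j\}$; a matrix is $k$-noncrossing if it has no $k+1$ pairwise crossing nonzero entries. -}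

module Defs where

open import Data.Nat using (ℕ; zero; suc; _+_; _∸_; _≤_; _<_; _⊓_; _⊔_; _≡ᵇ_)
open import Data.Bool using (Bool; true; false; _∧_; _∨_; not; if_then_else_)
open import Data.List using (List; []; _∷_; length)
open import Data.Bool.ListAction using (any)
open import Data.List.Membership.Propositional using (_∈_)
open import Data.List.Relation.Unary.All using (All)
open import Data.List.Relation.Unary.AllPairs using (AllPairs)
open import Data.Product using (_×_; _,_; Σ; ∃)
open import Data.Sum using (_⊎_)
open import Relation.Binary.PropositionalEquality using (_≡_; _≢_)
open import Relation.Nullary using (¬_)

-- An arc (s₁ , s₂) of a diagram, stored with s₁ < s₂.
Arc : Set
Arc = ℕ × ℕ

ValidArc : ℕ → Arc → Set
ValidArc n (s₁ , s₂) = 1 ≤ s₁ × s₁ < s₂ × s₂ ≤ n × 1 < s₂ ∸ s₁ × s₂ ∸ s₁ < n ∸ 1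

-- A diagram of length n: a simple graph on the sites {1,…,n}, given by its
-- (duplicate-free) list of arcs.
record Diagram (n : ℕ) : Set where
  field
    arcs   : List Arc
    unique : AllPairs _≢_ arcs
    valid  : All (ValidArc n) arcs
open Diagram public

Supports : ℕ → Arc → Set
Supports s (s₁ , s₂) = s ≡ s₁ ⊎ s ≡ s₂

supportsᵇ : ℕ → Arc → Bool
supportsᵇ s (s₁ , s₂) = (s ≡ᵇ s₁) ∨ (s ≡ᵇ s₂)

Binary : ∀ {n} → Diagram n → Set
Binary S =
  (Σ Arc λ x → x ∈ arcs S) ×
  (∀ s x y → x ∈ arcs S → y ∈ arcs S → Supports s x → Supports s y → x ≡ y)

CrossArc : Arc → Arc → Set
CrossArc (s₁ , s₂) (t₁ , t₂) =
  (s₁ < t₁ × t₁ < s₂ × s₂ < t₂) ⊎ (t₁ < s₁ × s₁ < t₂ × t₂ < s₂)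

KNoncrossingDiagram : ∀ {n} → ℕ → Diagram n → Set
KNoncrossingDiagram k S =
  ¬ (Σ (List Arc) λ xs →
       length xs ≡ suc k × All (_∈ arcs S) xs × AllPairs CrossArc xs)

isFree : List Arc → ℕ → Bool
isFree as s = not (any (supportsᵇ s) as)

freeCount : List Arc → ℕ → ℕ
freeCount as zero = zero
freeCount as (suc m) = freeCount as m + (if isFree as (suc m) then 1 else 0)

numFree : ∀ {n} → Diagram n → ℕ
numFree {n} S = freeCount (arcs S) n

-- Index i of the block B_i containing a (non-free) site s:
-- i = 1 + #{free sites u < s}, so that u_{i-1} < s < u_i.
block : List Arc → ℕ → ℕ
block as s = suc (freeCount as (s ∸ 1))

Regular : ∀ {n} → Diagram n → Set
Regular S =
  Binary S ×
  (∀ x y → x ∈ arcs S → y ∈ arcs S → CrossArc x y →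
     ∀ s t → Supports s x → Supports t y →
       block (arcs S) s ≢ block (arcs S) t)

countᵇ : {A : Set} → (A → Bool) → List A → ℕ
countᵇ p [] = zero
countᵇ p (x ∷ xs) = (if p x then 1 else 0) + countᵇ p xs

-- Block matrix entry b_{i,j} (indices 1 ≤ i,j ≤ f+1): number of arcs with
-- one supporting site in B_i and the other in B_j (for i = j: both in B_i).
blockMatrix : ∀ {n} → Diagram n → ℕ → ℕ → ℕ
blockMatrix S i j = countᵇ between (arcs S)
  where
  bl = block (arcs S)
  between : Arc → Bool
  between (s₁ , s₂) =
    ((bl s₁ ≡ᵇ i) ∧ (bl s₂ ≡ᵇ j)) ∨ ((bl s₁ ≡ᵇ j) ∧ (bl s₂ ≡ᵇ i))

Pos : Set
Pos = ℕ × ℕ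

CrossEntry : Pos → Pos → Set
CrossEntry (i , j) (p , q) =
  (i ≢ j × i ≢ p × i ≢ q × j ≢ p × j ≢ q × p ≢ q) ×
  ((i ⊓ j < p ⊓ q × p ⊓ q < i ⊔ j × i ⊔ j < p ⊔ q) ⊎
   (p ⊓ q < i ⊓ j × i ⊓ j < p ⊔ q × p ⊔ q < i ⊔ j))

NonzeroEntry : ℕ → (ℕ → ℕ → ℕ) → Pos → Set
NonzeroEntry m X (i , j) = 1 ≤ i × i ≤ m × 1 ≤ j × j ≤ m × X i j ≢ 0

KNoncrossingMatrix : ℕ → ℕ → (ℕ → ℕ → ℕ) → Set
KNoncrossingMatrix k m X =
  ¬ (Σ (List Pos) λ ps →
       length ps ≡ suc k × All (NonzeroEntry m X) ps × AllPairs CrossEntry ps)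

-- The map s ↦ block s is monotone, so it reflects strict order: an arc
-- realising a nonzero entry (i , j) has end blocks i ⊓ j and i ⊔ j, and a crossing
-- of two entries lifts to a crossing of the arcs realising them. Conversely, in a
-- regular diagram the four ends of two crossing arcs lie in four distinct blocks,
-- so the chain s₁ < t₁ < s₂ < t₂ stays strict after taking blocks and the two
-- block pairs are crossing entries. Either way a family of k + 1 pairwise crossing
-- objects is transported elementwise to the other side.
module Submission where

open import Defs
open import Data.Nat using (ℕ; suc; _≤_; _<_; _≤′_; ≤′-refl; ≤′-step; _⊓_; _⊔_; _≡ᵇ_; s≤s; z≤n)
open import Data.Nat.Properties
open import Data.Bool using (Bool; true; false; T; _∧_; _∨_)
open import Data.Bool.Properties using (T-∧; T-∨)
open import Data.List using (List; []; _∷_; length)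
open import Data.List.Membership.Propositional using (_∈_)
open import Data.List.Relation.Unary.Any using (here; there)
open import Data.List.Relation.Unary.All using (All; []; _∷_; lookup)
open import Data.List.Relation.Unary.AllPairs using (AllPairs; []; _∷_)
open import Data.Product using (_×_; _,_; Σ; proj₁; proj₂)
open import Data.Sum as Sum using (_⊎_; inj₁; inj₂; swap)
open import Relation.Nullary using (contradiction)
open import Function.Base using (_∘_)
open import Function.Bundles using (_⇔_; mk⇔; Equivalence)
open import Relation.Binary.PropositionalEquality
  using (_≡_; _≢_; ≢-sym; refl; sym; trans; subst; cong; cong₂; subst₂)

-- Both KNoncrossingDiagram k S and KNoncrossingMatrix k m X unfold to ¬ Clique … (suc k).
Clique : {A : Set} → (A → Set) → (A → A → Set) → ℕ → Set
Clique {A} P R m = Σ (List A) λ xs → length xs ≡ m × All P xs × AllPairs R xs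

module _ {A B : Set} {P : A → Set} {Q : B → Set}
         {R : A → A → Set} {R′ : B → B → Set}
         (f : ∀ {a} → P a → B)
         (f-Q : ∀ {a} (pa : P a) → Q (f pa))
         (f-R : ∀ {a b} (pa : P a) (pb : P b) → R a b → R′ (f pa) (f pb)) where

  private
    mapAll : ∀ {xs} → All P xs → List B
    mapAll []         = []
    mapAll (px ∷ pxs) = f px ∷ mapAll pxs

    length-mapAll : ∀ {xs} (pxs : All P xs) → length (mapAll pxs) ≡ length xs
    length-mapAll []        = refl
    length-mapAll (_ ∷ pxs) = cong suc (length-mapAll pxs)

    All-mapAll : ∀ {xs} (pxs : All P xs) → All Q (mapAll pxs)
    All-mapAll []         = []
    All-mapAll (px ∷ pxs) = f-Q px ∷ All-mapAll pxs

    All-R′-mapAll : ∀ {a xs} (pa : P a) (pxs : All P xs) → All (R a) xs →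
                    All (R′ (f pa)) (mapAll pxs)
    All-R′-mapAll pa []         []         = []
    All-R′-mapAll pa (px ∷ pxs) (r ∷ rs) = f-R pa px r ∷ All-R′-mapAll pa pxs rs

    AllPairs-mapAll : ∀ {xs} (pxs : All P xs) → AllPairs R xs → AllPairs R′ (mapAll pxs)
    AllPairs-mapAll []         []         = []
    AllPairs-mapAll (px ∷ pxs) (rs ∷ rss) =
      All-R′-mapAll px pxs rs ∷ AllPairs-mapAll pxs rss

  clique-map : ∀ {m} → Clique P R m → Clique Q R′ m
  clique-map (xs , len , pxs , rss) =
    mapAll pxs , trans (length-mapAll pxs) len , All-mapAll pxs , AllPairs-mapAll pxs rss

countᵇ≢0⇒∃ : ∀ {A : Set} (p : A → Bool) xs → countᵇ p xs ≢ 0 →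
             Σ A λ x → x ∈ xs × T (p x)
countᵇ≢0⇒∃ p []       c≢0 = contradiction refl c≢0
countᵇ≢0⇒∃ p (x ∷ xs) c≢0 with p x in px
... | true  = x , here refl , subst T (sym px) _
... | false with countᵇ≢0⇒∃ p xs c≢0
...   | y , y∈xs , py = y , there y∈xs , py

∈⇒countᵇ≢0 : ∀ {A : Set} (p : A → Bool) {x} xs → x ∈ xs → T (p x) → countᵇ p xs ≢ 0
∈⇒countᵇ≢0 p (y ∷ xs) x∈ px with p y in py
... | true  = λ ()
∈⇒countᵇ≢0 p (y ∷ xs) (here refl) px | false = contradiction (subst T py px) λ ()
∈⇒countᵇ≢0 p (y ∷ xs) (there x∈) px  | false = ∈⇒countᵇ≢0 p xs x∈ px

freeCount-mono : ∀ as {m n} → m ≤ n → freeCount as m ≤ freeCount as n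
freeCount-mono as m≤n = go (≤⇒≤′ m≤n)
  where
  go : ∀ {m n} → m ≤′ n → freeCount as m ≤ freeCount as n
  go ≤′-refl       = ≤-refl
  go (≤′-step m≤n) = ≤-trans (go m≤n) (m≤m+n _ _)

block-mono-≤ : ∀ as {s t} → s ≤ t → block as s ≤ block as t
block-mono-≤ as s≤t = s≤s (freeCount-mono as (∸-monoˡ-≤ 1 s≤t))

block-cancel-< : ∀ as {s t} → block as s < block as t → s < t
block-cancel-< as bs<bt = ≰⇒> λ t≤s → <⇒≱ bs<bt (block-mono-≤ as t≤s)

block≤1+freeCount : ∀ as {s n} → s ≤ n → block as s ≤ suc (freeCount as n)
block≤1+freeCount as s≤n = s≤s (freeCount-mono as (≤-trans (m∸n≤m _ 1) s≤n))

CrossArc-cancel : (f : ℕ → ℕ) → (∀ {s t} → f s < f t → s < t) →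
                  ∀ {s₁ s₂ t₁ t₂} → CrossArc (f s₁ , f s₂) (f t₁ , f t₂) →
                  CrossArc (s₁ , s₂) (t₁ , t₂)
CrossArc-cancel f cancel (inj₁ (a , b , c)) = inj₁ (cancel a , cancel b , cancel c)
CrossArc-cancel f cancel (inj₂ (a , b , c)) = inj₂ (cancel a , cancel b , cancel c)

CrossArc-map : (f : ℕ → ℕ) → (∀ {s t} → s ≤ t → f s ≤ f t) →
               ∀ {s₁ s₂ t₁ t₂} →
               (∀ s t → Supports s (s₁ , s₂) → Supports t (t₁ , t₂) → f s ≢ f t) →
               CrossArc (s₁ , s₂) (t₁ , t₂) → CrossArc (f s₁ , f s₂) (f t₁ , f t₂)
CrossArc-map f mono {s₁} {s₂} {t₁} {t₂} apart = map-cross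
  where
  strict : ∀ {s t} → s < t → f s ≢ f t → f s < f t
  strict s<t = ≤∧≢⇒< (mono (<⇒≤ s<t))

  map-cross : CrossArc (s₁ , s₂) (t₁ , t₂) → CrossArc (f s₁ , f s₂) (f t₁ , f t₂)
  map-cross (inj₁ (a , b , c)) =
    inj₁ ( strict a (apart s₁ t₁ (inj₁ refl) (inj₁ refl))
         , strict b (≢-sym (apart s₂ t₁ (inj₂ refl) (inj₁ refl)))
         , strict c (apart s₂ t₂ (inj₂ refl) (inj₂ refl)) )
  map-cross (inj₂ (a , b , c)) =
    inj₂ ( strict a (≢-sym (apart s₁ t₁ (inj₁ refl) (inj₁ refl)))
         , strict b (apart s₁ t₂ (inj₁ refl) (inj₂ refl))
         , strict c (≢-sym (apart s₂ t₂ (inj₂ refl) (inj₂ refl))) )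

CrossEntry-sym : ∀ {p q} → CrossEntry p q → CrossEntry q p
CrossEntry-sym ((i≢j , i≢p , i≢q , j≢p , j≢q , p≢q) , cross) =
  (p≢q , ≢-sym i≢p , ≢-sym j≢p , ≢-sym i≢q , ≢-sym j≢q , i≢j) , swap cross

<<<⇒CrossEntry : ∀ {a b c d} → a < b → b < c → c < d → CrossEntry (a , c) (b , d)
<<<⇒CrossEntry a<b b<c c<d
  rewrite m≤n⇒m⊓n≡m (<⇒≤ (<-trans a<b b<c)) | m≤n⇒m⊔n≡n (<⇒≤ (<-trans a<b b<c))
        | m≤n⇒m⊓n≡m (<⇒≤ (<-trans b<c c<d)) | m≤n⇒m⊔n≡n (<⇒≤ (<-trans b<c c<d)) =
  ( <⇒≢ (<-trans a<b b<c) , <⇒≢ a<b , <⇒≢ (<-trans (<-trans a<b b<c) c<d)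
  , >⇒≢ b<c , <⇒≢ c<d , <⇒≢ (<-trans b<c c<d) )
  , inj₁ (a<b , b<c , c<d)

CrossArc⇒CrossEntry : ∀ {p q} → CrossArc p q → CrossEntry p q
CrossArc⇒CrossEntry (inj₁ (a , b , c)) = <<<⇒CrossEntry a b c
CrossArc⇒CrossEntry (inj₂ (a , b , c)) = CrossEntry-sym (<<<⇒CrossEntry a b c)

blocks : List Arc → Arc → Pos
blocks as (s₁ , s₂) = block as s₁ , block as s₂

T-≡ᵇ-unordered : ∀ {a b i j} → T (((a ≡ᵇ i) ∧ (b ≡ᵇ j)) ∨ ((a ≡ᵇ j) ∧ (b ≡ᵇ i))) →
                 (a ≡ i × b ≡ j) ⊎ (a ≡ j × b ≡ i)
T-≡ᵇ-unordered eqs = Sum.map T-≡ᵇ-pair T-≡ᵇ-pair (Equivalence.to T-∨ eqs)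
  where
  T-≡ᵇ-pair : ∀ {c d k l} → T ((c ≡ᵇ k) ∧ (d ≡ᵇ l)) → c ≡ k × d ≡ l
  T-≡ᵇ-pair {c} {d} {k} {l} t with Equivalence.to T-∧ t
  ... | c≡ᵇk , d≡ᵇl = ≡ᵇ⇒≡ c k c≡ᵇk , ≡ᵇ⇒≡ d l d≡ᵇl

unordered⇒sorted : ∀ {a b i j} → a ≤ b → (a ≡ i × b ≡ j) ⊎ (a ≡ j × b ≡ i) →
                   (a , b) ≡ (i ⊓ j , i ⊔ j)
unordered⇒sorted a≤b (inj₁ (refl , refl)) =
  cong₂ _,_ (sym (m≤n⇒m⊓n≡m a≤b)) (sym (m≤n⇒m⊔n≡n a≤b))
unordered⇒sorted a≤b (inj₂ (refl , refl)) =
  cong₂ _,_ (sym (m≥n⇒m⊓n≡n a≤b)) (sym (m≥n⇒m⊔n≡m a≤b))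

module _ {n} (S : Diagram n) where

  private
    Entry : Pos → Set
    Entry = NonzeroEntry (suc (numFree S)) (blockMatrix S)

  nonzero⇒arc : ∀ {i j} → Entry (i , j) →
                Σ Arc λ x → x ∈ arcs S × blocks (arcs S) x ≡ (i ⊓ j , i ⊔ j)
  nonzero⇒arc (_ , _ , _ , _ , b≢0) with countᵇ≢0⇒∃ _ (arcs S) b≢0
  ... | x , x∈S , x-between with lookup (valid S) x∈S
  ...   | _ , s₁<s₂ , _ =
    x , x∈S , unordered⇒sorted (block-mono-≤ (arcs S) (<⇒≤ s₁<s₂)) (T-≡ᵇ-unordered x-between)

  entryArc : ∀ {p} → Entry p → Arc
  entryArc e = proj₁ (nonzero⇒arc e)

  entryArc-∈ : ∀ {p} (e : Entry p) → entryArc e ∈ arcs S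
  entryArc-∈ e = proj₁ (proj₂ (nonzero⇒arc e))

  -- The order part of CrossEntry p q is CrossArc of the sorted pairs of p and q.
  CrossEntry⇒CrossArc : ∀ {p q} (e : Entry p) (e′ : Entry q) →
                        CrossEntry p q → CrossArc (entryArc e) (entryArc e′)
  CrossEntry⇒CrossArc e e′ (_ , cross) =
    CrossArc-cancel (block (arcs S)) (block-cancel-< (arcs S))
      (subst₂ CrossArc (sym (proj₂ (proj₂ (nonzero⇒arc e))))
                       (sym (proj₂ (proj₂ (nonzero⇒arc e′)))) cross)

  arc⇒nonzeroEntry : ∀ {x} → x ∈ arcs S → Entry (blocks (arcs S) x)
  arc⇒nonzeroEntry {s₁ , s₂} x∈S with lookup (valid S) x∈S
  ... | _ , s₁<s₂ , s₂≤n , _ =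
    s≤s z≤n , block≤1+freeCount (arcs S) (≤-trans (<⇒≤ s₁<s₂) s₂≤n) ,
    s≤s z≤n , block≤1+freeCount (arcs S) s₂≤n ,
    ∈⇒countᵇ≢0 _ (arcs S) x∈S
      (Equivalence.from T-∨ (inj₁ (Equivalence.from T-∧
        (≡⇒≡ᵇ (block (arcs S) s₁) _ refl , ≡⇒≡ᵇ (block (arcs S) s₂) _ refl))))

  regular-CrossArc⇒CrossEntry : Regular S → ∀ {x y} → x ∈ arcs S → y ∈ arcs S →
                                CrossArc x y →
                                CrossEntry (blocks (arcs S) x) (blocks (arcs S) y)
  regular-CrossArc⇒CrossEntry (_ , blocks-apart) x∈S y∈S cross =
    CrossArc⇒CrossEntry (CrossArc-map (block (arcs S)) (block-mono-≤ (arcs S))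
                                      (blocks-apart _ _ x∈S y∈S cross) cross)

proposition3p3 : (n : ℕ) (S : Diagram n) (k : ℕ) → 1 ≤ k → Regular S →
                   KNoncrossingDiagram k S ⇔
                     KNoncrossingMatrix k (suc (numFree S)) (blockMatrix S)
proposition3p3 n S k _ regular = mk⇔
  (λ noArcClique → noArcClique ∘
     clique-map (entryArc S) (entryArc-∈ S) (CrossEntry⇒CrossArc S))
  (λ noEntryClique → noEntryClique ∘
     clique-map (λ {x} _ → blocks (arcs S) x) (arc⇒nonzeroEntry S)
                (regular-CrossArc⇒CrossEntry S regular))
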